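{- For every reset multi-counter system $\mathcal M=(Q,C,\delta,Q_0)$ there are a finite set $A$ of attributes with a tree order and an $\mathrm{ND\text{ - }LTL}^-$ formula $\Phi_{\mathcal M}$ over the set of atomic propositions $AP=Q\cup\{\mathrm{inc},\mathrm{dec},\mathrm{res}\}\cup C$ and attributes $A$ such that $\Phi_{\mathcal M}$ is satisfiable if and only if there is an infinite data word $w\in(2^{AP}\times\Delta^A)^\omega$ whose string projection is $\{p_0\}\{p_1\}\cdots$ with $p_i\in AP$ such that $p_0p_1\cdots$ is a run of $\mathcal M$.
   Context: A reset multi-counter system (rMCS) is $\mathcal M=(Q,C,\delta,Q_0)$ with finite sets $Q$ of states and $C$ of counters, initial states $Q_0\subseteq Q$ and $\delta\subseteq Q\times OP\times C\times Q$ where $OP=\{\mathrm{inc},\mathrm{dec},\mathrm{res}\}$. A run is a sequence $\rho\in Q_0\times(OP\times C\times Q)^\infty$ such that every subsequence $(q,op,c,q')$ of consecutive entries with $q,q'\in Q$ lies in $\delta$, and there is an injective map sending every position $i$ with $(\rho_i,\rho_{i+1})=(\mathrm{dec},c)$ to a position $j<i$ with $(\rho_j,\rho_{j+1})=(\mathrm{inc},c)$ such that $(\rho_l,\rho_{l+1})\ne(\mathrm{res},c)$ for all $j<l<i$. The string projection of $w=(a_0,\vec d_0)(a_1,\vec d_1)\cdots$ is $a_0a_1\cdots$. ND-LTL: fix an infinite data domain $\Delta$, finite $AP$, and a finite attribute set $A$ with a tree order $\le$ (a partial order such that for every $x$, $x^\downarrow=\{y:y\le x\}$ is linearly ordered).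 Data words are sequences $w=(a_0,\vec d_0)(a_1,\vec d_1)\cdots$ with $a_i\in 2^{AP}$, $\vec d_i:A\to\Delta$. Syntax: position formulae $\varphi ::= p\mid\varphi\wedge\varphi\mid\neg\varphi\mid\mathrm X\varphi\mid\mathrm Y\varphi\mid\varphi\mathrm U\varphi\mid\varphi\mathrm S\varphi\mid\mathrm C^r_x\psi$; class formulae $\psi::=@x\mid\psi\wedge\psi\mid\neg\psi\mid\mathrm X^=\psi\mid\mathrm Y^=\psi\mid\psi\mathrm U^=\psi\mid\psi\mathrm S^=\psi\mid\varphi$ ($p\in AP$, $x\in A$, $r\in\mathbb Z$). For $x\in A$ with $x^\downarrow=\{x_1<\dots<x_n\}$ and $\vec d\in\Delta^{x^\downarrow}$ associate the vector $(\vec d(x_1),\dots,\vec d(x_n))$; write $\vec d\simeq\vec d'$ if they have the same vector. Let $\mathrm{pos}_{\vec d}(w)=\{i:\exists y\in A,\ \vec d\simeq\vec d_i|_{y^\downarrow}\}$. Position formulae at $(w,i)$: $p$ iff $p\in a_i$; Boolean and LTL operators $\mathrm X,\mathrm Y,\mathrm U,\mathrm S$ as usual; $(w,i)\models\mathrm C^r_x\psi$ iff $0\le i+r<|w|$ and $(w,i+r,\vec d_i|_{x^\downarrow})\models\psi$. Class formulae at $(w,i,\vec d)$: $\varphi$ iff $(w,i)\models\varphi$; $@x$ iff $\vec d_i|_{x^\downarrow}\simeq\vec d$; $\mathrm X^=\psi$ iff some $j\in\mathrm{pos}_{\vec d}(w)$ has $j>i$ and for the smallest such $j$, $(w,j,\vec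 d)\models\psi$; $\psi_1\mathrm U^=\psi_2$ iff some $j\in\mathrm{pos}_{\vec d}(w)$, $j\ge i$, has $(w,j,\vec d)\models\psi_2$ and all $j'\in\mathrm{pos}_{\vec d}(w)$ with $i\le j'<j$ satisfy $\psi_1$; $\mathrm Y^=,\mathrm S^=$ are the symmetric past versions. A formula is satisfiable if $(w,0)\models\varphi$ for some data word $w$ (here infinite). $\mathrm{ND\text{ - }LTL}^-$ is the fragment without $\mathrm X^=$ and $\mathrm U^=$. -}

module Defs where

open import Data.Nat using (ℕ; zero; suc; _+_; _*_; _≤_; _<_)
open import Data.Integer as ℤ using (ℤ; +_)
open import Data.Fin using (Fin)
open import Data.Bool using (Bool; true)
open import Data.List using (List; map)
open import Data.List.Membership.Propositional using (_∈_)
open import Data.List.Relation.Unary.Linked using (Linked)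
open import Data.Product using (Σ; ∃; _×_; _,_; proj₁; proj₂)
open import Data.Sum using (_⊎_)
open import Data.Unit using (⊤)
open import Data.Empty using (⊥)
open import Relation.Nullary using (¬_)
open import Relation.Binary.PropositionalEquality using (_≡_; _≢_)
open import Relation.Binary.Structures using (IsPartialOrder)
open import Function.Bundles using (_⇔_)

data OP : Set where
  inc dec res : OP

-- Q = Fin nQ, C = Fin nC; δ ⊆ Q × OP × C × Q and Q₀ ⊆ Q as
-- (decidable, Bool-valued) characteristic functions of finite subsets.
record RMCS : Set where
  field
    nQ nC : ℕ
    δ  : Fin nQ → OP → Fin nC → Fin nQ → Bool
    Q₀ : Fin nQ → Bool

data AtomP (Q C : Set) : Set where
  st  : Q → AtomP Q C
  opA : OP → AtomP Q C
  ctr : C → AtomP Q C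

APof : RMCS → Set
APof M = AtomP (Fin (RMCS.nQ M)) (Fin (RMCS.nC M))

-- infinite runs: the sequence ρ = ρ₀ ρ₁ ρ₂ … (ρ ∈ Q₀ × (OP × C × Q)^ω)
module _ (M : RMCS) where
  open RMCS M

  DecPos : (ℕ → APof M) → ℕ → Set
  DecPos ρ i = ∃ λ c → ρ i ≡ opA dec × ρ (suc i) ≡ ctr c

  IsRun : (ρ : ℕ → APof M) → Set
  IsRun ρ =
    (∃ λ q → ρ 0 ≡ st q × Q₀ q ≡ true)
    × (∀ k → Σ (Fin nQ) λ q → Σ OP λ o → Σ (Fin nC) λ c → Σ (Fin nQ) λ q' →
          ρ (3 * k) ≡ st q × ρ (3 * k + 1) ≡ opA o
          × ρ (3 * k + 2) ≡ ctr c × ρ (3 * k + 3) ≡ st q'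
          × δ q o c q' ≡ true)
    × (Σ (ℕ → ℕ) λ f →
          (∀ i c → ρ i ≡ opA dec → ρ (suc i) ≡ ctr c →
             f i < i × ρ (f i) ≡ opA inc × ρ (suc (f i)) ≡ ctr c
             × (∀ l → f i < l → l < i →
                  ¬ (ρ l ≡ opA res × ρ (suc l) ≡ ctr c)))
          × (∀ i i' → DecPos ρ i → DecPos ρ i' → f i ≡ f i' → i ≡ i'))

IsTreeOrder : ∀ {n} → (Fin n → Fin n → Set) → Set
IsTreeOrder {n} _⊑_ =
  IsPartialOrder _≡_ _⊑_
  × (∀ x y z → y ⊑ x → z ⊑ x → y ⊑ z ⊎ z ⊑ y)

mutual
  data PF (P A : Set) : Set where
    atom : P → PF P A
    _∧_  : PF P A → PF P A → PF P A
    ¬ₚ_  : PF P A → PF P A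
    X Y  : PF P A → PF P A
    _U_ _S_ : PF P A → PF P A → PF P A
    C    : ℤ → A → CF P A → PF P A

  data CF (P A : Set) : Set where
    at    : A → CF P A
    _∧ᶜ_  : CF P A → CF P A → CF P A
    ¬ᶜ_   : CF P A → CF P A
    X⁼ Y⁼ : CF P A → CF P A
    _U⁼_ _S⁼_ : CF P A → CF P A → CF P A
    pos   : PF P A → CF P A

mutual
  Minus : ∀ {P A} → PF P A → Set
  Minus (atom p) = ⊤
  Minus (φ ∧ ψ) = Minus φ × Minus ψ
  Minus (¬ₚ φ) = Minus φ
  Minus (X φ) = Minus φ
  Minus (Y φ) = Minus φ
  Minus (φ U ψ) = Minus φ × Minus ψ
  Minus (φ S ψ) = Minus φ × Minus ψ
  Minus (C r x ψ) = Minusᶜ ψ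

  Minusᶜ : ∀ {P A} → CF P A → Set
  Minusᶜ (at x) = ⊤
  Minusᶜ (φ ∧ᶜ ψ) = Minusᶜ φ × Minusᶜ ψ
  Minusᶜ (¬ᶜ φ) = Minusᶜ φ
  Minusᶜ (X⁼ φ) = ⊥
  Minusᶜ (Y⁼ φ) = Minusᶜ φ
  Minusᶜ (φ U⁼ ψ) = ⊥
  Minusᶜ (φ S⁼ ψ) = Minusᶜ φ × Minusᶜ ψ
  Minusᶜ (pos φ) = Minus φ

module Sem (Δ : Set) (P : Set) {n : ℕ} (_⊑_ : Fin n → Fin n → Set) where

  Letter : Set
  Letter = (P → Bool) × (Fin n → Δ)

  Word : Set
  Word = ℕ → Letter

  -- DownVec d x v : v is the vector (d x₁, …, d xₘ) where x↓ = {x₁ < … < xₘ}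
  DownVec : (Fin n → Δ) → Fin n → List Δ → Set
  DownVec d x v = Σ (List (Fin n)) λ ys →
    Linked (λ y y' → y ⊑ y' × y ≢ y') ys
    × (∀ y → (y ∈ ys) ⇔ (y ⊑ x))
    × v ≡ map d ys

  InPos : Word → List Δ → ℕ → Set
  InPos w v i = ∃ λ y → DownVec (proj₂ (w i)) y v

  mutual
    ⟦_⟧ : PF P (Fin n) → Word → ℕ → Set
    ⟦ atom p ⟧ w i = proj₁ (w i) p ≡ true
    ⟦ φ ∧ ψ ⟧ w i = ⟦ φ ⟧ w i × ⟦ ψ ⟧ w i
    ⟦ ¬ₚ φ ⟧ w i = ¬ ⟦ φ ⟧ w i
    ⟦ X φ ⟧ w i = ⟦ φ ⟧ w (suc i)
    ⟦ Y φ ⟧ w zero = ⊥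
    ⟦ Y φ ⟧ w (suc i) = ⟦ φ ⟧ w i
    ⟦ φ U ψ ⟧ w i = ∃ λ j → i ≤ j × ⟦ ψ ⟧ w j
                      × (∀ k → i ≤ k → k < j → ⟦ φ ⟧ w k)
    ⟦ φ S ψ ⟧ w i = ∃ λ j → j ≤ i × ⟦ ψ ⟧ w j
                      × (∀ k → j < k → k ≤ i → ⟦ φ ⟧ w k)
    ⟦ C r x ψ ⟧ w i = ∃ λ j → (+ j ≡ (+ i) ℤ.+ r)
                      × Σ (List Δ) λ v → DownVec (proj₂ (w i)) x v × ⟦ ψ ⟧ᶜ w j v

    ⟦_⟧ᶜ : CF P (Fin n) → Word → ℕ → List Δ → Set
    ⟦ at x ⟧ᶜ w i v = DownVec (proj₂ (w i)) x v
    ⟦ φ ∧ᶜ ψ ⟧ᶜ w i v = ⟦ φ ⟧ᶜ w i v × ⟦ ψ ⟧ᶜ w i v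
    ⟦ ¬ᶜ φ ⟧ᶜ w i v = ¬ ⟦ φ ⟧ᶜ w i v
    ⟦ X⁼ ψ ⟧ᶜ w i v = ∃ λ j → i < j × InPos w v j
                      × (∀ k → i < k → k < j → ¬ InPos w v k) × ⟦ ψ ⟧ᶜ w j v
    ⟦ Y⁼ ψ ⟧ᶜ w i v = ∃ λ j → j < i × InPos w v j
                      × (∀ k → j < k → k < i → ¬ InPos w v k) × ⟦ ψ ⟧ᶜ w j v
    ⟦ φ U⁼ ψ ⟧ᶜ w i v = ∃ λ j → i ≤ j × InPos w v j × ⟦ ψ ⟧ᶜ w j v
                      × (∀ k → i ≤ k → k < j → InPos w v k → ⟦ φ ⟧ᶜ w k v)
    ⟦ φ S⁼ ψ ⟧ᶜ w i v = ∃ λ j → j ≤ i × InPos w v j × ⟦ ψ ⟧ᶜ w j v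
                      × (∀ k → j < k → k ≤ i → InPos w v k → ⟦ φ ⟧ᶜ w k v)
    ⟦ pos φ ⟧ᶜ w i v = ⟦ φ ⟧ w i

  Satisfiable : PF P (Fin n) → Set
  Satisfiable Φ = Σ Word λ w → ⟦ Φ ⟧ w 0

Satisfiable : (Δ : Set) {P : Set} {n : ℕ} → (Fin n → Fin n → Set) → PF P (Fin n) → Set
Satisfiable Δ {P} _⊑_ Φ = Sem.Satisfiable Δ P _⊑_ Φ

HasRunWord : (Δ : Set) (M : RMCS) (n : ℕ) → Set
HasRunWord Δ M n =
  Σ (ℕ → (APof M → Bool) × (Fin n → Δ)) λ w →
  Σ (ℕ → APof M) λ ρ →
    (∀ i a → (proj₁ (w i) a ≡ true) ⇔ (a ≡ ρ i)) × IsRun M ρ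

module Submission where

-- Φ checks the control flow of a run locally on the labels: an initial state, every state
-- followed by the operation, counter and target state of a transition (three positions per
-- step), and at most one atom per position. The counters are handled with data. Each counter c
-- has two attributes epoch c ⊑ token c. The epoch value of c is kept until a reset of c and is
-- new after it, and at a dec of c the previous position of the same (epoch c, token c)-class
-- must be an inc of c; as the epoch is part of the class, that inc lies after the last reset.
--
-- From a run we take as epoch value the position where the current epoch began, and give a dec
-- the token of its matching inc; injectivity of the matching makes Y⁼ find exactly that inc.
-- Conversely, two decs cannot be linked to the same inc (the earlier would lie in between), so
-- up to any dec the decs of an epoch inject into its earlier incs. These links exist only under
-- double negation, so the matching is defined by counting instead, matching the k-th dec of an
-- epoch with its k-th inc; the links only prove the decidable inequality that makes this work.

open import Defs
open import Level using (0ℓ)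
open import Data.Nat using (ℕ; zero; suc; _+_; _*_; _≤_; _<_; z≤n; s≤s; _≤?_; _<?_)
open import Data.Nat.Properties
open import Data.Integer using (+_; -[1+_])
import Data.Integer.Properties as ℤ
open import Data.Fin using (Fin; _↑ˡ_; _↑ʳ_; splitAt; join)
open import Data.Fin.Properties using (splitAt-↑ˡ; splitAt-↑ʳ; join-splitAt) renaming (_≟_ to _≟ᶠ_)
open import Data.Bool using (Bool; true; false; if_then_else_)
open import Data.Bool.Properties using () renaming (_≟_ to _≟ᵇ_)
open import Data.List using (List; []; _∷_; map; _++_; allFin; cartesianProduct)
open import Data.List.Properties using (∷-injectiveˡ; ∷-injectiveʳ)
open import Data.List.Membership.Propositional using (_∈_; lose)
open import Data.List.Membership.Propositional.Properties using (∈-map⁺; ∈-++⁺ˡ; ∈-++⁺ʳ; ∈-allFin; ∈-cartesianProduct⁺)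
open import Data.List.Relation.Unary.Any using (here; there; any?; satisfied)
open import Data.List.Relation.Unary.Linked as Linked using (Linked)
open import Data.Product using (Σ; ∃; _×_; _,_; proj₁; proj₂)
open import Data.Sum using (_⊎_; inj₁; inj₂; [_,_]′)
open import Data.Unit using (⊤; tt)
open import Data.Empty using (⊥)
open import Relation.Nullary using (¬_; Dec; yes; no; does; contradiction)
open import Relation.Nullary.Negation using (¬¬-map; ¬¬-Monad)
open import Relation.Nullary.Decidable using (map′; ¬?; _×-dec_; dec-true; decidable-stable)
open import Relation.Unary using (Decidable)
open import Relation.Binary.Definitions using (DecidableEquality; tri<; tri≈; tri>)
open import Relation.Binary.PropositionalEquality
open import Effect.Monad using (RawMonad)
open import Function.Base using (_∘_; case_of_)
open import Function.Bundles using (_↣_; _⇔_; mk⇔; Equivalence; Injection)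

open RawMonad (¬¬-Monad {0ℓ}) using (_⊗_; _>>=_)

count : {P : ℕ → Set} → Decidable P → ℕ → ℕ
count P? zero = 0
count P? (suc n) with P? n
... | yes _ = suc (count P? n)
... | no _ = count P? n

module _ {P : ℕ → Set} (P? : Decidable P) where

  count-≤-suc : ∀ n → count P? n ≤ count P? (suc n)
  count-≤-suc n with P? n
  ... | yes _ = n≤1+n (count P? n)
  ... | no _ = ≤-refl

  count-mono : ∀ {j n} → j ≤ n → count P? j ≤ count P? n
  count-mono j≤n with m≤n⇒m<n∨m≡n j≤n
  ... | inj₂ refl = ≤-refl
  ... | inj₁ (s≤s {n = n} j≤n) = ≤-trans (count-mono j≤n) (count-≤-suc n)

  count-suc : ∀ {n} → P n → count P? (suc n) ≡ suc (count P? n)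
  count-suc {n} pn with P? n
  ... | yes _ = refl
  ... | no ¬pn = contradiction pn ¬pn

  count-< : ∀ {j n} → P j → j < n → count P? j < count P? n
  count-< pj j<n = ≤-trans (≤-reflexive (sym (count-suc pj))) (count-mono j<n)

  count-witness : ∀ {k} n → k < count P? n → ∃ λ j → j < n × P j × count P? j ≡ k
  count-witness (suc n) k<c with P? n
  count-witness (suc n) k<c | no _ with count-witness n k<c
  ... | j , j<n , pj , cj = j , m<n⇒m<1+n j<n , pj , cj
  count-witness (suc n) k<c | yes pn with m<1+n⇒m<n∨m≡n k<c
  ... | inj₂ refl = n , ≤-refl , pn , refl
  ... | inj₁ k<c′ with count-witness n k<c′
  ...   | j , j<n , pj , cj = j , m<n⇒m<1+n j<n , pj , cj

count-cong : ∀ {P Q : ℕ → Set} (P? : Decidable P) (Q? : Decidable Q) n →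
             (∀ j → j < n → (P j → Q j) × (Q j → P j)) → count P? n ≡ count Q? n
count-cong P? Q? zero _ = refl
count-cong P? Q? (suc n) P⇔Q with P? n | Q? n | P⇔Q n ≤-refl
... | yes _ | yes _ | _ = cong suc (count-cong P? Q? n λ j j<n → P⇔Q j (m<n⇒m<1+n j<n))
... | no _ | no _ | _ = count-cong P? Q? n λ j j<n → P⇔Q j (m<n⇒m<1+n j<n)
... | yes p | no ¬q | (to , _) = contradiction (to p) ¬q
... | no ¬p | yes q | (_ , from) = contradiction (from q) ¬p

remove : ∀ {P : ℕ → Set} → Decidable P → (j₀ : ℕ) → Decidable (λ j → P j × j ≢ j₀)
remove P? j₀ j = P? j ×-dec ¬? (j ≟ j₀)

count-remove : ∀ {Q : ℕ → Set} (Q? : Decidable Q) {j₀} n → j₀ < n → Q j₀ →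
               count Q? n ≡ suc (count (remove Q? j₀) n)
count-remove Q? {j₀} (suc n) j₀<1+n qj₀ with m<1+n⇒m<n∨m≡n j₀<1+n
... | inj₂ refl with Q? j₀ | remove Q? j₀ j₀
...   | no ¬qj₀ | _ = contradiction qj₀ ¬qj₀
...   | yes _ | yes (_ , j₀≢j₀) = contradiction refl j₀≢j₀
...   | yes _ | no _ = cong suc (count-cong Q? (remove Q? j₀) j₀ λ j j<j₀ →
                         (λ qj → qj , <⇒≢ j<j₀) , λ (qj , _) → qj)
count-remove Q? {j₀} (suc n) _ qj₀ | inj₁ j₀<n
  with Q? n | remove Q? j₀ n | count-remove Q? n j₀<n qj₀
... | yes _ | yes _ | eq = cong suc eq
... | no _ | no _ | eq = eq
... | yes qn | no ¬qn′ | _ = contradiction (qn , >⇒≢ j₀<n) ¬qn′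
... | no ¬qn | yes (qn , _) | _ = contradiction qn ¬qn

count-≤-injection : ∀ {P Q : ℕ → Set} (R : ℕ → ℕ → Set) (P? : Decidable P) (Q? : Decidable Q) N M →
  (∀ k → k < N → P k → ∃ λ j → j < M × Q j × R k j) →
  (∀ {k k′ j} → R k j → R k′ j → k ≡ k′) →
  count P? N ≤ count Q? M
count-≤-injection R P? Q? zero M _ _ = z≤n
count-≤-injection {P} {Q} R P? Q? (suc N) M total injective with P? N
... | no _ = count-≤-injection R P? Q? N M (λ k k<N → total k (m<n⇒m<1+n k<N)) injective
... | yes pN with total N ≤-refl pN
...   | j₀ , j₀<M , qj₀ , rNj₀ = begin
  suc (count P? N)
    ≤⟨ s≤s (count-≤-injection R P? (remove Q? j₀) N M total′ injective) ⟩
  suc (count (remove Q? j₀) M)  ≡⟨ count-remove Q? M j₀<M qj₀ ⟨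
  count Q? M                    ∎
  where
  open ≤-Reasoning
  total′ : ∀ k → k < N → P k → ∃ λ j → j < M × (Q j × j ≢ j₀) × R k j
  total′ k k<N pk with total k (m<n⇒m<1+n k<N) pk
  ... | j , j<M , qj , rkj = j , j<M , (qj , λ { refl → <⇒≢ k<N (injective rkj rNj₀) }) , rkj

¬¬-∀< : ∀ {P : ℕ → Set} N → (∀ k → k < N → ¬ ¬ P k) → ¬ ¬ (∀ k → k < N → P k)
¬¬-∀< zero _ ¬all = ¬all λ _ ()
¬¬-∀< {P} (suc N) ¬¬P = ¬¬-map extend (¬¬-∀< N (λ k k<N → ¬¬P k (m<n⇒m<1+n k<N)) ⊗ ¬¬P N ≤-refl)
  where
  extend : (∀ k → k < N → P k) × P N → ∀ k → k < suc N → P k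
  extend (below , pN) k k<1+N with m<1+n⇒m<n∨m≡n k<1+N
  ... | inj₁ k<N = below k k<N
  ... | inj₂ refl = pN

¬¬-→ : ∀ {A B : Set} → Dec A → (A → ¬ ¬ B) → ¬ ¬ (A → B)
¬¬-→ (yes a) ¬¬b = ¬¬-map (λ b _ → b) (¬¬b a)
¬¬-→ (no ¬a) _ ¬→ = ¬→ λ a → contradiction a ¬a

does-true⇒ : ∀ {A : Set} (a? : Dec A) → does a? ≡ true → A
does-true⇒ (yes a) _ = a

module EpochTokenOrder (nC : ℕ) where

  Attr : Set
  Attr = Fin (nC + nC)

  epoch token : Fin nC → Attr
  epoch c = c ↑ˡ nC
  token c = nC ↑ʳ c

  data AttrView : Attr → Set where
    epoch-view : ∀ c → AttrView (epoch c)
    token-view : ∀ c → AttrView (token c)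

  view : ∀ y → AttrView y
  view y = subst AttrView (join-splitAt nC nC y) (view-split (splitAt nC y))
    where
    view-split : ∀ s → AttrView (join nC nC s)
    view-split (inj₁ c) = epoch-view c
    view-split (inj₂ c) = token-view c

  data Below : Fin nC ⊎ Fin nC → Fin nC ⊎ Fin nC → Set where
    same : ∀ {s} → Below s s
    epoch<token : ∀ {c} → Below (inj₁ c) (inj₂ c)

  _⊑_ : Attr → Attr → Set
  y ⊑ z = Below (splitAt nC y) (splitAt nC z)

  ⊑-isTreeOrder : IsTreeOrder _⊑_
  ⊑-isTreeOrder = record
    { isPreorder = record
      { isEquivalence = isEquivalence
      ; reflexive = λ { refl → same }
      ; trans = Below-trans }
    ; antisym = λ {y} {z} p q → splitAt-injective y z (Below-antisym p q) }
    , λ _ _ _ → Below-tree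
    where
    Below-trans : ∀ {s t u} → Below s t → Below t u → Below s u
    Below-trans same q = q
    Below-trans epoch<token same = epoch<token

    Below-antisym : ∀ {s t} → Below s t → Below t s → s ≡ t
    Below-antisym same _ = refl

    Below-tree : ∀ {s t u} → Below s u → Below t u → Below s t ⊎ Below t s
    Below-tree same q = inj₂ q
    Below-tree epoch<token same = inj₁ epoch<token
    Below-tree epoch<token epoch<token = inj₁ same

    splitAt-injective : ∀ y z → splitAt nC y ≡ splitAt nC z → y ≡ z
    splitAt-injective y z eq = begin
      y                           ≡⟨ join-splitAt nC nC y ⟨
      join nC nC (splitAt nC y)   ≡⟨ cong (join nC nC) eq ⟩
      join nC nC (splitAt nC z)   ≡⟨ join-splitAt nC nC z ⟩
      z                           ∎
      where open ≡-Reasoning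

  epoch⊑token : ∀ c → epoch c ⊑ token c
  epoch⊑token c rewrite splitAt-↑ˡ nC c nC | splitAt-↑ʳ nC nC c = epoch<token

  token⋢epoch : ∀ c c′ → ¬ token c ⊑ epoch c′
  token⋢epoch c c′ p rewrite splitAt-↑ˡ nC c′ nC | splitAt-↑ʳ nC nC c with p
  ... | ()

  epoch≢token : ∀ c c′ → epoch c ≢ token c′
  epoch≢token c c′ eq
    with trans (sym (splitAt-↑ˡ nC c nC)) (trans (cong (splitAt nC) eq) (splitAt-↑ʳ nC nC c′))
  ... | ()

  ⊑-epoch : ∀ {y} c → y ⊑ epoch c → y ≡ epoch c
  ⊑-epoch {y} c p with view y
  ... | token-view c′ = contradiction p (token⋢epoch c′ c)
  ... | epoch-view c′ rewrite splitAt-↑ˡ nC c′ nC | splitAt-↑ˡ nC c nC with p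
  ...   | same = refl

  ⊑-token : ∀ {y} c → y ⊑ token c → y ≡ epoch c ⊎ y ≡ token c
  ⊑-token {y} c p with view y
  ... | epoch-view c′ rewrite splitAt-↑ˡ nC c′ nC | splitAt-↑ʳ nC nC c with p
  ...   | epoch<token = inj₁ refl
  ⊑-token {y} c p | token-view c′ rewrite splitAt-↑ʳ nC nC c′ | splitAt-↑ʳ nC nC c with p
  ...   | same = inj₂ refl

  module DownVectors (Δ P : Set) where
    open Sem Δ P _⊑_

    epochVector tokenVector : (Attr → Δ) → Fin nC → List Δ
    epochVector d c = d (epoch c) ∷ []
    tokenVector d c = d (epoch c) ∷ d (token c) ∷ []

    StrictChain : List Attr → Set
    StrictChain = Linked (λ y y′ → y ⊑ y′ × y ≢ y′)

    Enumerates : List Attr → Attr → Set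
    Enumerates ys x = ∀ y → (y ∈ ys) ⇔ (y ⊑ x)

    epoch-chain : ∀ c {ys} → StrictChain ys → Enumerates ys (epoch c) → ys ≡ epoch c ∷ []
    epoch-chain c {[]} _ enum with Equivalence.from (enum (epoch c)) same
    ... | ()
    epoch-chain c {y ∷ []} _ enum = cong (_∷ []) (⊑-epoch c (Equivalence.to (enum y) (here refl)))
    epoch-chain c {y ∷ y′ ∷ _} ((_ , y≢y′) Linked.∷ _) enum = contradiction
      (trans (⊑-epoch c (Equivalence.to (enum y) (here refl)))
             (sym (⊑-epoch c (Equivalence.to (enum y′) (there (here refl)))))) y≢y′

    token-chain : ∀ c {ys} → StrictChain ys → Enumerates ys (token c) → ys ≡ epoch c ∷ token c ∷ []
    token-chain c {[]} _ enum with Equivalence.from (enum (token c)) same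
    ... | ()
    token-chain c {y ∷ []} _ enum with Equivalence.from (enum (epoch c)) (epoch⊑token c)
                                      | Equivalence.from (enum (token c)) same
    ... | here refl | here eq = contradiction (sym eq) (epoch≢token c c)
    token-chain c {y ∷ y′ ∷ ys} ((y⊑y′ , y≢y′) Linked.∷ chain) enum
      with ⊑-token c (Equivalence.to (enum y) (here refl))
         | ⊑-token c (Equivalence.to (enum y′) (there (here refl)))
    ... | inj₁ refl | inj₁ refl = contradiction refl y≢y′
    ... | inj₂ refl | inj₂ refl = contradiction refl y≢y′
    ... | inj₂ refl | inj₁ refl = contradiction y⊑y′ (token⋢epoch c c)
    ... | inj₁ refl | inj₂ refl = cong (λ zs → epoch c ∷ token c ∷ zs)
      (nothing-above (λ z z∈ys → Equivalence.to (enum z) (there (there z∈ys))) chain)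
      where
      nothing-above : ∀ {zs} → (∀ z → z ∈ zs → z ⊑ token c) → StrictChain (token c ∷ zs) → zs ≡ []
      nothing-above {[]} _ _ = refl
      nothing-above {z ∷ _} below ((token⊑z , token≢z) Linked.∷ _)
        with ⊑-token c (below z (here refl))
      ... | inj₁ refl = contradiction token⊑z (token⋢epoch c c)
      ... | inj₂ refl = contradiction refl token≢z

    downVec-epoch : ∀ d c → DownVec d (epoch c) (epochVector d c)
    downVec-epoch d c = epoch c ∷ [] , Linked.[-] , enum , refl
      where
      enum : Enumerates (epoch c ∷ []) (epoch c)
      enum y = mk⇔ (λ { (here refl) → same }) (λ y⊑ → here (⊑-epoch c y⊑))

    downVec-token : ∀ d c → DownVec d (token c) (tokenVector d c)
    downVec-token d c =
      epoch c ∷ token c ∷ [] , (epoch⊑token c , epoch≢token c c) Linked.∷ Linked.[-] , enum , refl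
      where
      enum : Enumerates (epoch c ∷ token c ∷ []) (token c)
      enum y = mk⇔ (λ { (here refl) → epoch⊑token c ; (there (here refl)) → same })
        (λ y⊑ → [ here , there ∘ here ]′ (⊑-token c y⊑))

    downVec-epoch-unique : ∀ d c {v} → DownVec d (epoch c) v → v ≡ epochVector d c
    downVec-epoch-unique d c (ys , chain , enum , refl) rewrite epoch-chain c chain enum = refl

    downVec-token-unique : ∀ d c {v} → DownVec d (token c) v → v ≡ tokenVector d c
    downVec-token-unique d c (ys , chain , enum , refl) rewrite token-chain c chain enum = refl

module Connectives {P A : Set} (p₀ : P) where

  True False : PF P A
  True = ¬ₚ (atom p₀ ∧ (¬ₚ atom p₀))
  False = ¬ₚ True

  _⇒_ _∨_ : PF P A → PF P A → PF P A
  φ ⇒ ψ = ¬ₚ (φ ∧ (¬ₚ ψ))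
  φ ∨ ψ = ¬ₚ ((¬ₚ φ) ∧ (¬ₚ ψ))

  G : PF P A → PF P A
  G φ = ¬ₚ (True U (¬ₚ φ))

  ⋀ ⋁ : {I : Set} → List I → (I → PF P A) → PF P A
  ⋀ [] φ = True
  ⋀ (i ∷ is) φ = φ i ∧ ⋀ is φ
  ⋁ [] φ = False
  ⋁ (i ∷ is) φ = φ i ∨ ⋁ is φ

  guard : Bool → PF P A → PF P A
  guard b φ = if b then φ else False

  -- Local formulas only inspect labels, so their truth is decidable (Local-dec): this is what
  -- undoes the double negations with which ⇒ and G are encoded.
  Local : PF P A → Set
  Local (atom p) = ⊤
  Local (φ ∧ ψ) = Local φ × Local ψ
  Local (¬ₚ φ) = Local φ
  Local (X φ) = Local φ
  Local _ = ⊥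

  Local⇒Minus : ∀ φ → Local φ → Minus φ
  Local⇒Minus (atom p) _ = tt
  Local⇒Minus (φ ∧ ψ) (lφ , lψ) = Local⇒Minus φ lφ , Local⇒Minus ψ lψ
  Local⇒Minus (¬ₚ φ) lφ = Local⇒Minus φ lφ
  Local⇒Minus (X φ) lφ = Local⇒Minus φ lφ

  Minus-G : ∀ {φ} → Minus φ → Minus (G φ)
  Minus-G mφ = (tt , tt) , mφ

  Minus-⋀ : ∀ {I : Set} (is : List I) φ → (∀ i → Minus (φ i)) → Minus (⋀ is φ)
  Minus-⋀ [] φ _ = tt , tt
  Minus-⋀ (i ∷ is) φ mφ = mφ i , Minus-⋀ is φ mφ

  Local-True : Local True
  Local-True = tt , tt

  Local-⋀ : ∀ {I : Set} (is : List I) φ → (∀ i → Local (φ i)) → Local (⋀ is φ)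
  Local-⋀ [] φ _ = Local-True
  Local-⋀ (i ∷ is) φ lφ = lφ i , Local-⋀ is φ lφ

  Local-⋁ : ∀ {I : Set} (is : List I) φ → (∀ i → Local (φ i)) → Local (⋁ is φ)
  Local-⋁ [] φ _ = Local-True
  Local-⋁ (i ∷ is) φ lφ = lφ i , Local-⋁ is φ lφ

  Local-guard : ∀ b {φ} → Local φ → Local (guard b φ)
  Local-guard true lφ = lφ
  Local-guard false _ = Local-True

module ConnectiveSemantics (Δ P : Set) (p₀ : P) {n : ℕ} (_⊑_ : Fin n → Fin n → Set) where
  open Connectives {P} {Fin n} p₀
  open Sem Δ P _⊑_

  True-holds : ∀ w i → ⟦ True ⟧ w i
  True-holds w i (p , ¬p) = ¬p p

  False-fails : ∀ w i → ¬ ⟦ False ⟧ w i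
  False-fails w i holds = holds (True-holds w i)

  Local-dec : ∀ φ → Local φ → ∀ w i → Dec (⟦ φ ⟧ w i)
  Local-dec (atom p) _ w i = proj₁ (w i) p ≟ᵇ true
  Local-dec (φ ∧ ψ) (lφ , lψ) w i = Local-dec φ lφ w i ×-dec Local-dec ψ lψ w i
  Local-dec (¬ₚ φ) lφ w i = ¬? (Local-dec φ lφ w i)
  Local-dec (X φ) lφ w i = Local-dec φ lφ w (suc i)

  ⇒-intro : ∀ {φ ψ w i} → (⟦ φ ⟧ w i → ⟦ ψ ⟧ w i) → ⟦ φ ⇒ ψ ⟧ w i
  ⇒-intro f (a , ¬b) = ¬b (f a)

  ⇒-elim : ∀ {φ ψ w i} → ⟦ φ ⇒ ψ ⟧ w i → ⟦ φ ⟧ w i → ¬ ¬ ⟦ ψ ⟧ w i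
  ⇒-elim φ⇒ψ a ¬b = φ⇒ψ (a , ¬b)

  G-intro : ∀ {φ w i} → (∀ j → i ≤ j → ⟦ φ ⟧ w j) → ⟦ G φ ⟧ w i
  G-intro always (j , i≤j , ¬φ , _) = ¬φ (always j i≤j)

  G-elim : ∀ {φ w i} → ⟦ G φ ⟧ w i → ∀ j → i ≤ j → ¬ ¬ ⟦ φ ⟧ w j
  G-elim {w = w} always j i≤j ¬φ = always (j , i≤j , ¬φ , λ k _ _ → True-holds w k)

  ⋀-intro : ∀ {I : Set} (is : List I) φ {w i} → (∀ a → a ∈ is → ⟦ φ a ⟧ w i) → ⟦ ⋀ is φ ⟧ w i
  ⋀-intro [] φ {w} {i} _ = True-holds w i
  ⋀-intro (a ∷ is) φ all = all a (here refl) , ⋀-intro is φ (λ b b∈is → all b (there b∈is))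

  ⋀-elim : ∀ {I : Set} (is : List I) φ {w i} → ⟦ ⋀ is φ ⟧ w i → ∀ a → a ∈ is → ⟦ φ a ⟧ w i
  ⋀-elim (_ ∷ is) φ (φa , _) a (here refl) = φa
  ⋀-elim (_ ∷ is) φ (_ , rest) a (there a∈is) = ⋀-elim is φ rest a a∈is

  ⋁-intro : ∀ {I : Set} (is : List I) φ {w i} a → a ∈ is → ⟦ φ a ⟧ w i → ⟦ ⋁ is φ ⟧ w i
  ⋁-intro (_ ∷ is) φ a (here refl) φa (¬φa , _) = ¬φa φa
  ⋁-intro (_ ∷ is) φ a (there a∈is) φa (_ , ¬rest) = ¬rest (⋁-intro is φ a a∈is φa)

  ⋁-elim : ∀ {I : Set} (is : List I) φ {w i} → (∀ a → Local (φ a)) →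
           ⟦ ⋁ is φ ⟧ w i → ∃ λ a → a ∈ is × ⟦ φ a ⟧ w i
  ⋁-elim [] φ {w} {i} _ holds = contradiction holds (False-fails w i)
  ⋁-elim (b ∷ is) φ {w} {i} lφ some with Local-dec (φ b) (lφ b) w i
  ... | yes φb = b , here refl , φb
  ... | no ¬φb with Local-dec (⋁ is φ) (Local-⋁ is φ lφ) w i
  ...   | no ¬rest = contradiction (¬φb , ¬rest) some
  ...   | yes rest with ⋁-elim is φ lφ rest
  ...     | a , a∈is , φa = a , there a∈is , φa

  guard-intro : ∀ {b φ w i} → b ≡ true → ⟦ φ ⟧ w i → ⟦ guard b φ ⟧ w i
  guard-intro refl φi = φi

  guard-elim : ∀ b {φ w i} → ⟦ guard b φ ⟧ w i → b ≡ true × ⟦ φ ⟧ w i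
  guard-elim true φi = refl , φi
  guard-elim false {w = w} {i} holds = contradiction holds (False-fails w i)

_≟ₒ_ : DecidableEquality OP
inc ≟ₒ inc = yes refl
dec ≟ₒ dec = yes refl
res ≟ₒ res = yes refl
inc ≟ₒ dec = no λ ()
inc ≟ₒ res = no λ ()
dec ≟ₒ inc = no λ ()
dec ≟ₒ res = no λ ()
res ≟ₒ inc = no λ ()
res ≟ₒ dec = no λ ()

allOps : List OP
allOps = inc ∷ dec ∷ res ∷ []

∈-allOps : ∀ o → o ∈ allOps
∈-allOps inc = here refl
∈-allOps dec = there (here refl)
∈-allOps res = there (there (here refl))

residue-mod-3 : ∀ m → ∃ λ k → m ≡ 3 * k ⊎ m ≡ suc (3 * k) ⊎ m ≡ suc (suc (3 * k))
residue-mod-3 zero = 0 , inj₁ refl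
residue-mod-3 (suc m) with residue-mod-3 m
... | k , inj₁ refl = k , inj₂ (inj₁ refl)
... | k , inj₂ (inj₁ refl) = k , inj₂ (inj₂ refl)
... | k , inj₂ (inj₂ refl) = suc k , inj₁ (sym (*-suc 3 k))

module Encoding (M : RMCS) where
  open RMCS M
  open EpochTokenOrder nC

  AP : Set
  AP = APof M

  open Connectives {AP} {Attr} (opA inc)

  _≟ₐ_ : DecidableEquality AP
  st q ≟ₐ st q′ = map′ (cong st) (λ { refl → refl }) (q ≟ᶠ q′)
  opA o ≟ₐ opA o′ = map′ (cong opA) (λ { refl → refl }) (o ≟ₒ o′)
  ctr c ≟ₐ ctr c′ = map′ (cong ctr) (λ { refl → refl }) (c ≟ᶠ c′)
  st _ ≟ₐ opA _ = no λ ()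
  st _ ≟ₐ ctr _ = no λ ()
  opA _ ≟ₐ st _ = no λ ()
  opA _ ≟ₐ ctr _ = no λ ()
  ctr _ ≟ₐ st _ = no λ ()
  ctr _ ≟ₐ opA _ = no λ ()

  allAtoms : List AP
  allAtoms = map st (allFin nQ) ++ map opA allOps ++ map ctr (allFin nC)

  ∈-allAtoms : ∀ a → a ∈ allAtoms
  ∈-allAtoms (st q) = ∈-++⁺ˡ (∈-map⁺ st (∈-allFin q))
  ∈-allAtoms (opA o) = ∈-++⁺ʳ (map st (allFin nQ)) (∈-++⁺ˡ (∈-map⁺ opA (∈-allOps o)))
  ∈-allAtoms (ctr c) =
    ∈-++⁺ʳ (map st (allFin nQ)) (∈-++⁺ʳ (map opA allOps) (∈-map⁺ ctr (∈-allFin c)))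

  Formula : Set
  Formula = PF AP Attr

  isInitial : Fin nQ → Formula
  isInitial q = guard (Q₀ q) (atom (st q))

  initial : Formula
  initial = ⋁ (allFin nQ) isInitial

  Move : Set
  Move = OP × Fin nC × Fin nQ

  allMoves : List Move
  allMoves = cartesianProduct allOps (cartesianProduct (allFin nC) (allFin nQ))

  ∈-allMoves : ∀ m → m ∈ allMoves
  ∈-allMoves (o , c , q) =
    ∈-cartesianProduct⁺ (∈-allOps o) (∈-cartesianProduct⁺ (∈-allFin c) (∈-allFin q))

  step : Fin nQ → Move → Formula
  step q (o , c , q′) =
    guard (δ q o c q′) (X (atom (opA o)) ∧ (X (X (atom (ctr c))) ∧ X (X (X (atom (st q′))))))

  successor : Fin nQ → Formula
  successor q = ⋁ allMoves (step q)

  transitionFrom : Fin nQ → Formula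
  transitionFrom q = atom (st q) ⇒ successor q

  transitions : Formula
  transitions = ⋀ (allFin nQ) transitionFrom

  exclusive : AP × AP → Formula
  exclusive (a , b) = if does (a ≟ₐ b) then True else ¬ₚ (atom a ∧ atom b)

  atMostOne : Formula
  atMostOne = ⋀ (cartesianProduct allAtoms allAtoms) exclusive

  control : Formula
  control = transitions ∧ atMostOne

  opOn : OP → Fin nC → Formula
  opOn o c = atom (opA o) ∧ X (atom (ctr c))

  incBefore sameEpochNext newEpochNext : Fin nC → Formula
  incBefore c = C (+ 0) (token c) (Y⁼ (pos (opOn inc c) ∧ᶜ at (token c)))
  sameEpochNext c = C (+ 1) (epoch c) (at (epoch c))
  -- Evaluated at m, ¬ (True S⁼ True) says that the epoch value at m + 1 occurs nowhere up to m.
  newEpochNext c = X (C -[1+ 0 ] (epoch c) (¬ᶜ (pos True S⁼ pos True)))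

  decMatched epochKept epochFresh : Fin nC → Formula
  decMatched c = opOn dec c ⇒ incBefore c
  epochKept c = (¬ₚ opOn res c) ⇒ sameEpochNext c
  epochFresh c = opOn res c ⇒ newEpochNext c

  counterRules : Fin nC → Formula
  counterRules c = decMatched c ∧ (epochKept c ∧ epochFresh c)

  counters : Formula
  counters = ⋀ (allFin nC) counterRules

  Φ : Formula
  Φ = initial ∧ (G control ∧ G counters)

  Local-exclusive : ∀ ab → Local (exclusive ab)
  Local-exclusive (a , b) with does (a ≟ₐ b)
  ... | true = Local-True
  ... | false = tt , tt

  Local-step : ∀ q mv → Local (step q mv)
  Local-step q (o , c , q′) = Local-guard (δ q o c q′) (tt , tt , tt)

  Local-control : Local control
  Local-control = Local-⋀ (allFin nQ) transitionFrom
                          (λ q → tt , Local-⋁ allMoves (step q) (Local-step q))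
                , Local-⋀ (cartesianProduct allAtoms allAtoms) exclusive Local-exclusive

  Local-initial : Local initial
  Local-initial = Local-⋁ (allFin nQ) isInitial λ q → Local-guard (Q₀ q) tt

  Φ-minus : Minus Φ
  Φ-minus = Local⇒Minus initial Local-initial
          , Minus-G {control} (Local⇒Minus control Local-control)
          , Minus-G {counters} (Minus-⋀ (allFin nC) counterRules λ _ →
              ((tt , tt) , (tt , tt) , tt) , ((tt , tt) , tt) , ((tt , tt) , (tt , tt) , (tt , tt)))

module Epochs (M : RMCS) (ρ : ℕ → APof M) where
  open RMCS M
  open Encoding M

  OpOn : OP → Fin nC → ℕ → Set
  OpOn o c i = ρ i ≡ opA o × ρ (suc i) ≡ ctr c

  opOn? : ∀ o c → Decidable (OpOn o c)
  opOn? o c i = (ρ i ≟ₐ opA o) ×-dec (ρ (suc i) ≟ₐ ctr c)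

  decPos? : Decidable (DecPos M ρ)
  decPos? i with ρ i ≟ₐ opA dec | ρ (suc i)
  ... | no ¬d | _ = no λ (_ , d , _) → ¬d d
  ... | yes d | ctr c = yes (c , d , refl)
  ... | yes _ | st _ = no λ ()
  ... | yes _ | opA _ = no λ ()

  epochStart : Fin nC → ℕ → ℕ
  epochStart c zero = 0
  epochStart c (suc m) with opOn? res c m
  ... | yes _ = suc m
  ... | no _ = epochStart c m

  epochStart-≤ : ∀ c m → epochStart c m ≤ m
  epochStart-≤ c zero = z≤n
  epochStart-≤ c (suc m) with opOn? res c m
  ... | yes _ = ≤-refl
  ... | no _ = m≤n⇒m≤1+n (epochStart-≤ c m)

  epochStart-after-reset : ∀ c {m} → OpOn res c m → epochStart c (suc m) ≡ suc m
  epochStart-after-reset c {m} r with opOn? res c m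
  ... | yes _ = refl
  ... | no ¬r = contradiction r ¬r

  epochStart-no-reset : ∀ c {m} → ¬ OpOn res c m → epochStart c (suc m) ≡ epochStart c m
  epochStart-no-reset c {m} ¬r with opOn? res c m
  ... | yes r = contradiction r ¬r
  ... | no _ = refl

  epochStart-reset : ∀ c m {l} → epochStart c m ≡ suc l → OpOn res c l
  epochStart-reset c (suc m) eq with opOn? res c m
  ... | yes r = subst (OpOn res c) (suc-injective eq) r
  ... | no _ = epochStart-reset c m eq

  no-reset-in-epoch : ∀ c m {l} → epochStart c m ≤ l → l < m → ¬ OpOn res c l
  no-reset-in-epoch c (suc m) s≤l l<1+m with opOn? res c m | m<1+n⇒m<n∨m≡n l<1+m
  ... | yes _ | _ = contradiction s≤l (<⇒≱ l<1+m)
  ... | no _ | inj₁ l<m = no-reset-in-epoch c m s≤l l<m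
  ... | no ¬r | inj₂ refl = ¬r

  epochStart-const : ∀ c {j m} → j ≤ m → (∀ l → j ≤ l → l < m → ¬ OpOn res c l) →
                     epochStart c m ≡ epochStart c j
  epochStart-const c j≤m no-reset with m≤n⇒m<n∨m≡n j≤m
  ... | inj₂ refl = refl
  ... | inj₁ (s≤s {n = m} j≤m′) = trans (epochStart-no-reset c (no-reset m j≤m′ ≤-refl))
    (epochStart-const c j≤m′ λ l j≤l l<m → no-reset l j≤l (m<n⇒m<1+n l<m))

  epochStart-changed : ∀ c {i i′} → i ≤ i′ → epochStart c i ≢ epochStart c i′ → i < epochStart c i′
  epochStart-changed c {i} {i′} i≤i′ changed with i <? epochStart c i′
  ... | yes i<s = i<s
  ... | no i≮s = contradiction (sym (epochStart-const c i≤i′ λ l i≤l l<i′ →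
          no-reset-in-epoch c i′ (≤-trans (≮⇒≥ i≮s) i≤l) l<i′)) changed

module RunToModel (Δ : Set) (ι : ℕ ↣ Δ) (M : RMCS) (ρ : ℕ → APof M) (run : IsRun M ρ) where
  open RMCS M
  open Encoding M
  open Epochs M ρ
  open EpochTokenOrder nC
  open Connectives {AP} {Attr} (opA inc)
  open ConnectiveSemantics Δ AP (opA inc) _⊑_
  open Sem Δ AP _⊑_
  open DownVectors Δ AP
  open Injection ι using () renaming (to to ι⟨_⟩; injective to ι-injective)

  f : ℕ → ℕ
  f = proj₁ (proj₂ (proj₂ run))

  f-matches : ∀ i c → OpOn dec c i →
    f i < i × OpOn inc c (f i) × (∀ l → f i < l → l < i → ¬ OpOn res c l)
  f-matches i c (d , dc) with proj₁ (proj₂ (proj₂ (proj₂ run))) i c d dc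
  ... | fi<i , finc , fc , no-reset = fi<i , (finc , fc) , no-reset

  f-injective : ∀ i i′ → DecPos M ρ i → DecPos M ρ i′ → f i ≡ f i′ → i ≡ i′
  f-injective = proj₂ (proj₂ (proj₂ (proj₂ run)))

  -- A dec carries the token of the inc matched to it; other positions get a token of their own.
  tokenId : ℕ → ℕ
  tokenId m with decPos? m
  ... | yes _ = f m
  ... | no _ = m

  valueOfKind : ℕ → Fin nC ⊎ Fin nC → Δ
  valueOfKind m (inj₁ c) = ι⟨ epochStart c m ⟩
  valueOfKind m (inj₂ _) = ι⟨ tokenId m ⟩

  value : ℕ → Attr → Δ
  value m y = valueOfKind m (splitAt nC y)

  value-epoch : ∀ m c → value m (epoch c) ≡ ι⟨ epochStart c m ⟩
  value-epoch m c = cong (valueOfKind m) (splitAt-↑ˡ nC c nC)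

  value-token : ∀ m c → value m (token c) ≡ ι⟨ tokenId m ⟩
  value-token m c = cong (valueOfKind m) (splitAt-↑ʳ nC nC c)

  word : Word
  word m = (λ a → does (a ≟ₐ ρ m)) , value m

  atom-holds : ∀ {m a} → ρ m ≡ a → ⟦ atom a ⟧ word m
  atom-holds {m} {a} eq = dec-true (a ≟ₐ ρ m) (sym eq)

  atom-holds⇒ : ∀ {m a} → ⟦ atom a ⟧ word m → ρ m ≡ a
  atom-holds⇒ {m} {a} holds = sym (does-true⇒ (a ≟ₐ ρ m) holds)

  reindex : ∀ k n {a} → ρ (3 * k + n) ≡ a → ρ (n + 3 * k) ≡ a
  reindex k n {a} = subst (λ t → ρ t ≡ a) (+-comm (3 * k) n)

  state-step : ∀ {m q} → ρ m ≡ st q → ∃ λ mv → ⟦ step q mv ⟧ word m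
  state-step {m} eq with residue-mod-3 m
  ... | k , inj₁ refl with proj₁ (proj₂ run) k
  ...   | _ , o , c , q′ , e₀ , e₁ , e₂ , e₃ , δ-step with trans (sym eq) e₀
  ...     | refl = (o , c , q′) , guard-intro δ-step
                   ( atom-holds (reindex k 1 e₁) , atom-holds (reindex k 2 e₂)
                   , atom-holds (reindex k 3 e₃))
  state-step eq | k , inj₂ (inj₁ refl) with proj₁ (proj₂ run) k
  ... | _ , _ , _ , _ , _ , e₁ , _ = case trans (sym eq) (reindex k 1 e₁) of λ ()
  state-step eq | k , inj₂ (inj₂ refl) with proj₁ (proj₂ run) k
  ... | _ , _ , _ , _ , _ , _ , e₂ , _ = case trans (sym eq) (reindex k 2 e₂) of λ ()

  initial-holds : ⟦ initial ⟧ word 0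
  initial-holds with proj₁ run
  ... | q , eq , q-initial = ⋁-intro (allFin nQ) isInitial q (∈-allFin q)
                               (guard-intro q-initial (atom-holds eq))

  exclusive-holds : ∀ m ab → ⟦ exclusive ab ⟧ word m
  exclusive-holds m (a , b) with a ≟ₐ b
  ... | yes _ = True-holds word m
  ... | no a≢b = λ (at-a , at-b) → a≢b (trans (sym (atom-holds⇒ at-a)) (atom-holds⇒ at-b))

  control-holds : ∀ m → ⟦ control ⟧ word m
  control-holds m =
      ⋀-intro (allFin nQ) transitionFrom (λ q _ →
        ⇒-intro {atom (st q)} {successor q} λ at-q →
          let mv , holds = state-step (atom-holds⇒ at-q)
          in ⋁-intro allMoves (step q) mv (∈-allMoves mv) holds)
    , ⋀-intro (cartesianProduct allAtoms allAtoms) exclusive (λ ab _ → exclusive-holds m ab)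

  tokenId-inc : ∀ {c j} → OpOn inc c j → tokenId j ≡ j
  tokenId-inc {j = j} (inc-at , _) with decPos? j
  ... | no _ = refl
  ... | yes (_ , dec-at , _) = case trans (sym inc-at) dec-at of λ ()

  tokenId-dec : ∀ {j} → DecPos M ρ j → tokenId j ≡ f j
  tokenId-dec {j} dj with decPos? j
  ... | yes _ = refl
  ... | no ¬dj = contradiction dj ¬dj

  matched-tokenVector : ∀ m c → OpOn dec c m → tokenVector (value (f m)) c ≡ tokenVector (value m) c
  matched-tokenVector m c dm = cong₂ (λ a b → a ∷ b ∷ []) same-epoch same-token
    where
    fm<m = proj₁ (f-matches m c dm)
    inc-fm = proj₁ (proj₂ (f-matches m c dm))
    no-reset-between = proj₂ (proj₂ (f-matches m c dm))

    same-epoch : value (f m) (epoch c) ≡ value m (epoch c)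
    same-epoch = begin
      value (f m) (epoch c)    ≡⟨ value-epoch (f m) c ⟩
      ι⟨ epochStart c (f m) ⟩  ≡⟨ cong ι⟨_⟩ (epochStart-const c (<⇒≤ fm<m) no-reset) ⟨
      ι⟨ epochStart c m ⟩      ≡⟨ value-epoch m c ⟨
      value m (epoch c)        ∎
      where
      open ≡-Reasoning
      no-reset : ∀ l → f m ≤ l → l < m → ¬ OpOn res c l
      no-reset l fm≤l l<m with m≤n⇒m<n∨m≡n fm≤l
      ... | inj₁ fm<l = no-reset-between l fm<l l<m
      ... | inj₂ refl = λ (res-at , _) → case trans (sym (proj₁ inc-fm)) res-at of λ ()

    same-token : value (f m) (token c) ≡ value m (token c)
    same-token = begin
      value (f m) (token c)  ≡⟨ value-token (f m) c ⟩
      ι⟨ tokenId (f m) ⟩     ≡⟨ cong ι⟨_⟩ (tokenId-inc inc-fm) ⟩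
      ι⟨ f m ⟩               ≡⟨ cong ι⟨_⟩ (tokenId-dec (c , dm)) ⟨
      ι⟨ tokenId m ⟩         ≡⟨ value-token m c ⟨
      value m (token c)      ∎
      where open ≡-Reasoning

  decMatched-holds : ∀ m c → ⟦ decMatched c ⟧ word m
  decMatched-holds m c = ⇒-intro {opOn dec c} {incBefore c} {word} {m}
    λ (at-dec , at-c) → m , cong +_ (sym (+-identityʳ m)) , _ , downVec-token (value m) c
                          , previous-inc (atom-holds⇒ at-dec , atom-holds⇒ at-c)
    where
    v = tokenVector (value m) c

    previous-inc : OpOn dec c m → ⟦ Y⁼ (pos (opOn inc c) ∧ᶜ at (token c)) ⟧ᶜ word m v
    previous-inc dm = f m , fm<m , (token c , class-fm) , none-between
                    , (atom-holds (proj₁ inc-fm) , atom-holds (proj₂ inc-fm)) , class-fm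
      where
      fm<m = proj₁ (f-matches m c dm)
      inc-fm = proj₁ (proj₂ (f-matches m c dm))

      class-fm : DownVec (value (f m)) (token c) v
      class-fm = subst (DownVec (value (f m)) (token c)) (matched-tokenVector m c dm)
                       (downVec-token (value (f m)) c)

      none-between : ∀ k → f m < k → k < m → ¬ InPos word v k
      none-between k fm<k k<m (y , class-k) with view y
      ... | epoch-view c′ = case downVec-epoch-unique (value k) c′ class-k of λ ()
      ... | token-view c′ = same-tokenId-⊥ (ι-injective (begin
            ι⟨ tokenId m ⟩      ≡⟨ value-token m c ⟨
            value m (token c)
              ≡⟨ ∷-injectiveˡ (∷-injectiveʳ (downVec-token-unique (value k) c′ class-k)) ⟩
            value k (token c′)  ≡⟨ value-token k c′ ⟩
            ι⟨ tokenId k ⟩      ∎))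
        where
        open ≡-Reasoning
        same-tokenId-⊥ : tokenId m ≢ tokenId k
        same-tokenId-⊥ eq rewrite tokenId-dec (c , dm) with decPos? k
        ... | yes dk = <-irrefl (f-injective k m dk (c , dm) (sym eq)) k<m
        ... | no _ = <-irrefl eq fm<k

  epochKept-holds : ∀ m c → ⟦ epochKept c ⟧ word m
  epochKept-holds m c = ⇒-intro {¬ₚ opOn res c} {sameEpochNext c} {word} {m}
    λ no-res → suc m , cong +_ (sym (+-comm m 1)) , _ , downVec-epoch (value m) c
             , subst (DownVec (value (suc m)) (epoch c)) (cong (_∷ []) (kept no-res))
                     (downVec-epoch (value (suc m)) c)
    where
    kept : ¬ ⟦ opOn res c ⟧ word m → value (suc m) (epoch c) ≡ value m (epoch c)
    kept no-res = begin
      value (suc m) (epoch c)    ≡⟨ value-epoch (suc m) c ⟩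
      ι⟨ epochStart c (suc m) ⟩
        ≡⟨ cong ι⟨_⟩ (epochStart-no-reset c λ (r , rc) → no-res (atom-holds r , atom-holds rc)) ⟩
      ι⟨ epochStart c m ⟩        ≡⟨ value-epoch m c ⟨
      value m (epoch c)          ∎
      where open ≡-Reasoning

  epochFresh-holds : ∀ m c → ⟦ epochFresh c ⟧ word m
  epochFresh-holds m c = ⇒-intro {opOn res c} {newEpochNext c} {word} {m}
    λ (at-res , at-c) → m , refl , _ , downVec-epoch (value (suc m)) c
                      , fresh (epochStart-after-reset c (atom-holds⇒ at-res , atom-holds⇒ at-c))
    where
    fresh : epochStart c (suc m) ≡ suc m →
            ¬ ⟦ pos True S⁼ pos True ⟧ᶜ word m (epochVector (value (suc m)) c)
    fresh new (j , j≤m , (y , class-j) , _) with view y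
    ... | token-view c′ = case downVec-token-unique (value j) c′ class-j of λ ()
    ... | epoch-view c′ = <-irrefl reused (s≤s (≤-trans (epochStart-≤ c′ j) j≤m))
      where
      reused : epochStart c′ j ≡ suc m
      reused = trans (sym (ι-injective (begin
        ι⟨ epochStart c (suc m) ⟩  ≡⟨ value-epoch (suc m) c ⟨
        value (suc m) (epoch c)    ≡⟨ ∷-injectiveˡ (downVec-epoch-unique (value j) c′ class-j) ⟩
        value j (epoch c′)         ≡⟨ value-epoch j c′ ⟩
        ι⟨ epochStart c′ j ⟩       ∎))) new
        where open ≡-Reasoning

  counters-holds : ∀ m → ⟦ counters ⟧ word m
  counters-holds m = ⋀-intro (allFin nC) counterRules
    λ c _ → decMatched-holds m c , epochKept-holds m c , epochFresh-holds m c

  word-satisfies : ⟦ Φ ⟧ word 0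
  word-satisfies = initial-holds , G-intro {control} (λ m _ → control-holds m)
                                 , G-intro {counters} (λ m _ → counters-holds m)

module ModelToRun (Δ : Set) (M : RMCS) where
  open RMCS M
  open Encoding M
  open EpochTokenOrder nC
  open Connectives {AP} {Attr} (opA inc)
  open ConnectiveSemantics Δ AP (opA inc) _⊑_
  open Sem Δ AP _⊑_
  open DownVectors Δ AP

  module _ (w : Word) (sat : ⟦ Φ ⟧ w 0) where

    value : ℕ → Attr → Δ
    value m = proj₂ (w m)

    control-at : ∀ m → ⟦ control ⟧ w m
    control-at m = decidable-stable (Local-dec control Local-control w m)
                     (G-elim {control} {w} (proj₁ (proj₂ sat)) m z≤n)

    atom-unique : ∀ m {a b} → ⟦ atom a ⟧ w m → ⟦ atom b ⟧ w m → a ≡ b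
    atom-unique m {a} {b} at-a at-b
      with a ≟ₐ b | ⋀-elim (cartesianProduct allAtoms allAtoms) exclusive (proj₂ (control-at m))
                      (a , b) (∈-cartesianProduct⁺ (∈-allAtoms a) (∈-allAtoms b))
    ... | yes a≡b | _ = a≡b
    ... | no _ | excl = contradiction (at-a , at-b) excl

    -- A position carrying no atom is read as inc, hence the side condition of ρ-complete.
    ρ : ℕ → AP
    ρ m with any? (λ a → proj₁ (w m) a ≟ᵇ true) allAtoms
    ... | yes some = proj₁ (satisfied some)
    ... | no _ = opA inc

    ρ-sound : ∀ {m a} → ⟦ atom a ⟧ w m → ρ m ≡ a
    ρ-sound {m} {a} at-a with any? (λ a → proj₁ (w m) a ≟ᵇ true) allAtoms
    ... | yes some = atom-unique m (proj₂ (satisfied some)) at-a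
    ... | no none = contradiction (lose (∈-allAtoms a) at-a) none

    ρ-complete : ∀ {m a} → ρ m ≡ a → a ≢ opA inc → ⟦ atom a ⟧ w m
    ρ-complete {m} eq a≢inc with any? (λ a → proj₁ (w m) a ≟ᵇ true) allAtoms
    ... | yes some = subst (λ a → ⟦ atom a ⟧ w m) eq (proj₂ (satisfied some))
    ... | no _ = contradiction (sym eq) a≢inc

    initial-at : ∃ λ q → ⟦ atom (st q) ⟧ w 0 × Q₀ q ≡ true
    initial-at with ⋁-elim (allFin nQ) isInitial (λ q → Local-guard (Q₀ q) tt) (proj₁ sat)
    ... | q , _ , holds with guard-elim (Q₀ q) holds
    ...   | q-initial , at-q = q , at-q , q-initial

    step-at : ∀ m q → ⟦ atom (st q) ⟧ w m → Σ Move λ (o , c , q′) → δ q o c q′ ≡ true ×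
      ⟦ atom (opA o) ⟧ w (1 + m) × ⟦ atom (ctr c) ⟧ w (2 + m) × ⟦ atom (st q′) ⟧ w (3 + m)
    step-at m q at-q with ⋁-elim allMoves (step q) (Local-step q) (decidable-stable
      (Local-dec (successor q) (Local-⋁ allMoves (step q) (Local-step q)) w m)
      (⇒-elim {atom (st q)} {successor q} {w} {m}
        (⋀-elim (allFin nQ) transitionFrom (proj₁ (control-at m)) q (∈-allFin q)) at-q))
    ... | (o , c , q′) , _ , holds with guard-elim (δ q o c q′) holds
    ...   | δ-step , at-o , at-c , at-q′ = (o , c , q′) , δ-step , at-o , at-c , at-q′

    state-at : ∀ k → ∃ λ q → ⟦ atom (st q) ⟧ w (3 * k)
    state-at zero = let q , at-q , _ = initial-at in q , at-q
    state-at (suc k) with state-at k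
    ... | q , at-q with step-at (3 * k) q at-q
    ...   | (_ , _ , q′) , _ , _ , _ , at-q′ =
      q′ , subst (λ m → ⟦ atom (st q′) ⟧ w m) (sym (*-suc 3 k)) at-q′

    reindex : ∀ k n {a} → ρ (n + 3 * k) ≡ a → ρ (3 * k + n) ≡ a
    reindex k n {a} = subst (λ t → ρ t ≡ a) (+-comm n (3 * k))

    run-steps : ∀ k → Σ (Fin nQ) λ q → Σ OP λ o → Σ (Fin nC) λ c → Σ (Fin nQ) λ q′ →
      ρ (3 * k) ≡ st q × ρ (3 * k + 1) ≡ opA o × ρ (3 * k + 2) ≡ ctr c × ρ (3 * k + 3) ≡ st q′ ×
      δ q o c q′ ≡ true
    run-steps k with state-at k
    ... | q , at-q with step-at (3 * k) q at-q
    ...   | (o , c , q′) , δ-step , at-o , at-c , at-q′ =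
      q , o , c , q′ , ρ-sound at-q , reindex k 1 (ρ-sound at-o) , reindex k 2 (ρ-sound at-c)
        , reindex k 3 (ρ-sound at-q′) , δ-step

    open Epochs M ρ

    record DecLink (c : Fin nC) (k j : ℕ) : Set where
      field
        before : j < k
        inc-at : OpOn inc c j
        same-class : tokenVector (value j) c ≡ tokenVector (value k) c
        none-between : ∀ m → j < m → m < k → ¬ InPos w (tokenVector (value k) c) m

    record Constraints (c : Fin nC) (m : ℕ) : Set where
      field
        dec-linked : OpOn dec c m → ∃ (DecLink c m)
        epoch-kept : ¬ OpOn res c m → value (suc m) (epoch c) ≡ value m (epoch c)
        epoch-fresh : OpOn res c m → ∀ j → j ≤ m → value j (epoch c) ≢ value (suc m) (epoch c)

    opOn-holds : ∀ {o c m} → OpOn o c m → o ≢ inc → ⟦ opOn o c ⟧ w m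
    opOn-holds (at-o , at-c) o≢inc =
      ρ-complete at-o (λ { refl → o≢inc refl }) , ρ-complete at-c (λ ())

    link-of : ∀ c m → ⟦ incBefore c ⟧ w m → ∃ (DecLink c m)
    link-of c m (j₀ , j₀≡m+0 , v , class-m , j , j<j₀ , _ , none , (at-inc , at-c) , class-j)
      with trans (ℤ.+-injective j₀≡m+0) (+-identityʳ m)
    ... | refl = j , record
      { before = j<j₀
      ; inc-at = ρ-sound at-inc , ρ-sound at-c
      ; same-class = trans (sym (downVec-token-unique (value j) c class-j)) v≡
      ; none-between = λ k j<k k<m → subst (λ u → ¬ InPos w u k) v≡ (none k j<k k<m) }
      where
      v≡ : v ≡ tokenVector (value j₀) c
      v≡ = downVec-token-unique (value j₀) c class-m

    kept-of : ∀ c m → ⟦ sameEpochNext c ⟧ w m → value (suc m) (epoch c) ≡ value m (epoch c)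
    kept-of c m (j₀ , j₀≡m+1 , v , class-m , class-j₀)
      with trans (ℤ.+-injective j₀≡m+1) (+-comm m 1)
    ... | refl = ∷-injectiveˡ (trans (sym (downVec-epoch-unique (value (suc m)) c class-j₀))
                                     (downVec-epoch-unique (value m) c class-m))

    fresh-of : ∀ c m → ⟦ newEpochNext c ⟧ w m →
               ∀ j → j ≤ m → value j (epoch c) ≢ value (suc m) (epoch c)
    fresh-of c m (j₀ , j₀≡m , v , class , never) j j≤m reused with ℤ.+-injective j₀≡m
    ... | refl = never (j , j≤m , (epoch c , class-j) , True-holds w j , λ k _ _ _ → True-holds w k)
      where
      class-j : DownVec (value j) (epoch c) v
      class-j = subst (DownVec (value j) (epoch c))
        (trans (cong (_∷ []) reused) (sym (downVec-epoch-unique (value (suc m)) c class)))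
        (downVec-epoch (value j) c)

    linked-¬¬ : ∀ {c m} → ⟦ decMatched c ⟧ w m → ¬ ¬ (OpOn dec c m → ∃ (DecLink c m))
    linked-¬¬ {c} {m} holds = ¬¬-→ (opOn? dec c m) λ d →
      ¬¬-map (link-of c m) (⇒-elim {opOn dec c} {incBefore c} {w} holds (opOn-holds d λ ()))

    kept-¬¬ : ∀ {c m} → ⟦ epochKept c ⟧ w m →
              ¬ ¬ (¬ OpOn res c m → value (suc m) (epoch c) ≡ value m (epoch c))
    kept-¬¬ {c} {m} holds = ¬¬-→ (¬? (opOn? res c m)) λ ¬r →
      ¬¬-map (kept-of c m) (⇒-elim {¬ₚ opOn res c} {sameEpochNext c} {w} holds
        λ (at-res , at-c) → ¬r (ρ-sound at-res , ρ-sound at-c))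

    fresh-¬¬ : ∀ {c m} → ⟦ epochFresh c ⟧ w m →
               ¬ ¬ (OpOn res c m → ∀ j → j ≤ m → value j (epoch c) ≢ value (suc m) (epoch c))
    fresh-¬¬ {c} {m} holds = ¬¬-→ (opOn? res c m) λ r →
      ¬¬-map (fresh-of c m) (⇒-elim {opOn res c} {newEpochNext c} {w} holds (opOn-holds r λ ()))

    constraints : ∀ c m → ¬ ¬ Constraints c m
    constraints c m = G-elim {counters} {w} (proj₂ (proj₂ sat)) m z≤n >>= λ holds →
      let decM , keptM , freshM = ⋀-elim (allFin nC) counterRules
                                         holds c (∈-allFin c)
      in ¬¬-map (λ (d , k , f) → record { dec-linked = d ; epoch-kept = k ; epoch-fresh = f })
                (linked-¬¬ decM ⊗ (kept-¬¬ keptM ⊗ fresh-¬¬ freshM))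

    epoch-constant : ∀ c {a b} → a ≤ b → (∀ m → a ≤ m → m < b → Constraints c m) →
                     (∀ m → a ≤ m → m < b → ¬ OpOn res c m) → value b (epoch c) ≡ value a (epoch c)
    epoch-constant c a≤b cs no-reset with m≤n⇒m<n∨m≡n a≤b
    ... | inj₂ refl = refl
    ... | inj₁ (s≤s {n = b} a≤b′) =
      trans (Constraints.epoch-kept (cs b a≤b′ ≤-refl) (no-reset b a≤b′ ≤-refl))
            (epoch-constant c a≤b′ (λ m a≤m m<b → cs m a≤m (m<n⇒m<1+n m<b))
                                   (λ m a≤m m<b → no-reset m a≤m (m<n⇒m<1+n m<b)))

    shared-inc-in-class : ∀ {c k k′ j} → DecLink c k j → DecLink c k′ j →
                          InPos w (tokenVector (value k′) c) k
    shared-inc-in-class {c} {k} l l′ = token c , subst (DownVec (value k) (token c))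
      (trans (sym (DecLink.same-class l)) (DecLink.same-class l′)) (downVec-token (value k) c)

    link-injective : ∀ {c k k′ j} → DecLink c k j → DecLink c k′ j → k ≡ k′
    link-injective {k = k} {k′} l l′ with <-cmp k k′
    ... | tri≈ _ k≡k′ _ = k≡k′
    ... | tri< k<k′ _ _ =
      contradiction (shared-inc-in-class l l′) (DecLink.none-between l′ k (DecLink.before l) k<k′)
    ... | tri> _ _ k′<k =
      contradiction (shared-inc-in-class l′ l) (DecLink.none-between l k′ (DecLink.before l′) k′<k)

    link-in-epoch : ∀ c {i k j} → (∀ m → m < i → Constraints c m) → k ≤ i → epochStart c i ≤ k →
                    DecLink c k j → epochStart c i ≤ j
    link-in-epoch c {i} {k} {j} cs k≤i s≤k link with epochStart c i ≤? j
    ... | yes s≤j = s≤j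
    ... | no s≰j with epochStart c i in es
    ...   | zero = contradiction z≤n s≰j
    ...   | suc l = contradiction same-epoch (Constraints.epoch-fresh (cs l (<-≤-trans s≤k k≤i))
                                                (epochStart-reset c i es) j (≤-pred (≰⇒> s≰j)))
      where
      same-epoch : value j (epoch c) ≡ value (suc l) (epoch c)
      same-epoch = trans (∷-injectiveˡ (DecLink.same-class link)) (epoch-constant c s≤k
        (λ m _ m<k → cs m (<-≤-trans m<k k≤i))
        (λ m l<m m<k → no-reset-in-epoch c i (subst (_≤ m) (sym es) l<m) (<-≤-trans m<k k≤i)))

    OpSince : OP → Fin nC → ℕ → ℕ → Set
    OpSince o c s j = OpOn o c j × s ≤ j

    opSince? : ∀ o c s → Decidable (OpSince o c s)
    opSince? o c s j = opOn? o c j ×-dec (s ≤? j)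

    incs decs : Fin nC → ℕ → ℕ → ℕ
    incs c s = count (opSince? inc c s)
    decs c s = count (opSince? dec c s)

    decs-≤-incs : ∀ c {i} → OpOn dec c i →
                  suc (decs c (epochStart c i) i) ≤ incs c (epochStart c i) i
    decs-≤-incs c {i} di =
      decidable-stable (_ ≤? _) (¬¬-map bound (¬¬-∀< (suc i) λ m _ → constraints c m))
      where
      s = epochStart c i
      bound : (∀ m → m < suc i → Constraints c m) → suc (decs c s i) ≤ incs c s i
      bound cs = subst (_≤ incs c s i) (count-suc (opSince? dec c s) (di , epochStart-≤ c i))
        (count-≤-injection (DecLink c) (opSince? dec c s) (opSince? inc c s) (suc i) i
                           linked link-injective)
        where
        linked : ∀ k → k < suc i → OpSince dec c s k →
                 ∃ λ j → j < i × OpSince inc c s j × DecLink c k j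
        linked k (s≤s k≤i) (dk , s≤k) with Constraints.dec-linked (cs k (s≤s k≤i)) dk
        ... | j , link = j , <-≤-trans (DecLink.before link) k≤i
                       , ( DecLink.inc-at link
                         , link-in-epoch c (λ m m<i → cs m (m<n⇒m<1+n m<i)) k≤i s≤k link)
                       , link

    Partner : Fin nC → ℕ → ℕ → Set
    Partner c i j =
      j < i × OpSince inc c (epochStart c i) j × incs c (epochStart c i) j ≡ decs c (epochStart c i) i

    partner : ∀ c i → OpOn dec c i → ∃ (Partner c i)
    partner c i di = count-witness (opSince? inc c (epochStart c i)) i (decs-≤-incs c di)

    f : ℕ → ℕ
    f i with decPos? i
    ... | yes (c , di) = proj₁ (partner c i di)
    ... | no _ = 0

    f-partner : ∀ c {i} → OpOn dec c i → Partner c i (f i)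
    f-partner c {i} di with decPos? i
    ... | no ¬di = contradiction (c , di) ¬di
    ... | yes (c′ , di′) with trans (sym (proj₂ di′)) (proj₂ di)
    ...   | refl = proj₂ (partner c i di′)

    f-matches : ∀ i c → ρ i ≡ opA dec → ρ (suc i) ≡ ctr c →
      f i < i × ρ (f i) ≡ opA inc × ρ (suc (f i)) ≡ ctr c × (∀ l → f i < l → l < i → ¬ OpOn res c l)
    f-matches i c d dc with f-partner c (d , dc)
    ... | fi<i , ((inc-at , c-at) , s≤fi) , _ = fi<i , inc-at , c-at ,
          λ l fi<l l<i → no-reset-in-epoch c i (≤-trans s≤fi (<⇒≤ fi<l)) l<i

    partners-distinct : ∀ c {i i′} → i < i′ → OpOn dec c i → OpOn dec c i′ → f i ≢ f i′
    partners-distinct c {i} {i′} i<i′ di di′ fi≡fi′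
      with f-partner c di | f-partner c di′ | epochStart c i ≟ epochStart c i′
    ... | fi<i , _ , _ | _ , (_ , s′≤fi′) , _ | no s≢s′ =
      <-irrefl fi≡fi′ (<-trans fi<i (<-≤-trans (epochStart-changed c (<⇒≤ i<i′) s≢s′) s′≤fi′))
    ... | _ , _ , counted | _ , _ , counted′ | yes s≡s′ = <-irrefl same-count fewer
      where
      s′ = epochStart c i′
      same-count : decs c s′ i ≡ decs c s′ i′
      same-count = begin
        decs c s′ i       ≡⟨ subst (λ s → incs c s (f i) ≡ decs c s i) s≡s′ counted ⟨
        incs c s′ (f i)   ≡⟨ cong (incs c s′) fi≡fi′ ⟩
        incs c s′ (f i′)  ≡⟨ counted′ ⟩
        decs c s′ i′      ∎
        where open ≡-Reasoning
      fewer : decs c s′ i < decs c s′ i′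
      fewer = count-< (opSince? dec c s′) (di , subst (_≤ i) s≡s′ (epochStart-≤ c i)) i<i′

    f-injective : ∀ i i′ → DecPos M ρ i → DecPos M ρ i′ → f i ≡ f i′ → i ≡ i′
    f-injective i i′ (c , di) (c′ , di′) fi≡fi′ with f-partner c di | f-partner c′ di′
    ... | _ , ((_ , c-at) , _) , _ | _ , ((_ , c′-at) , _) , _
      with trans (sym c-at) (trans (cong (λ t → ρ (suc t)) fi≡fi′) c′-at)
    ...   | refl with <-cmp i i′
    ...     | tri≈ _ i≡i′ _ = i≡i′
    ...     | tri< i<i′ _ _ = contradiction fi≡fi′ (partners-distinct c i<i′ di di′)
    ...     | tri> _ _ i′<i = contradiction (sym fi≡fi′) (partners-distinct c i′<i di′ di)

    ρ-is-run : IsRun M ρ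
    ρ-is-run = (let q , at-q , q-initial = initial-at in q , ρ-sound at-q , q-initial)
             , run-steps , f , f-matches , f-injective

    has-run-word : HasRunWord Δ M (nC + nC)
    has-run-word = (λ m → (λ a → does (a ≟ₐ ρ m)) , value m) , ρ
                 , (λ m a → mk⇔ (does-true⇒ (a ≟ₐ ρ m)) (dec-true (a ≟ₐ ρ m))) , ρ-is-run

lemma4 : (Δ : Set) → (ℕ ↣ Δ) → (M : RMCS) →
    Σ ℕ λ n → Σ (Fin n → Fin n → Set) λ _⊑_ → IsTreeOrder _⊑_ ×
    Σ (PF (APof M) (Fin n)) λ Φ → Minus Φ ×
    (Satisfiable Δ _⊑_ Φ ⇔ HasRunWord Δ M n)
lemma4 Δ ι M = nC + nC , _⊑_ , ⊑-isTreeOrder , Φ , Φ-minus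
  , mk⇔ (λ (w , sat) → ModelToRun.has-run-word Δ M w sat)
        (λ (_ , ρ , _ , run) → RunToModel.word Δ ι M ρ run , RunToModel.word-satisfies Δ ι M ρ run)
  where
  open RMCS M
  open EpochTokenOrder nC
  open Encoding M
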